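{- Let $p_1,\dots,p_n\in(0,\tfrac12]$, let $h(x)=Ax+b$ be drawn from $\mathcal{H}_{\{p_i\}}(n,n)$, and fix $\alpha\in\{0,1\}^n$. For every $1\le m\le n$ and $S\subseteq\{0,1\}^n$: (1) $\mathsf{E}[\mathrm{Cnt}_m(S)]=\frac{|S|}{2^m}$; (2) $\sum_{y_1,y_2\in S}\Pr[h^{(m)}(y_1)=h^{(m)}(y_2)=\alpha^{(m)}]=2^{ -m}\sum_{x\in S}\sum_{w=0}^{n}c_S(w,x)\,q(w,m)$, where the left sum is over all ordered pairs $(y_1,y_2)\in S\times S$.
   Context: All arithmetic is over $\mathbb{F}_2$. $\mathcal{H}_{\{p_i\}}(n,n)$: random $h(x)=Ax+b$, $A\in\mathbb{F}_2^{n\times n}$, $b\in\mathbb{F}_2^n$, all entries independent, entries of row $i$ of $A$ Bernoulli$(p_i)$, entries of $b$ Bernoulli$(1/2)$. $h^{(m)}(x)=A^{(m)}x+b^{(m)}$ with $A^{(m)}$ the first $m$ rows of $A$ and $b^{(m)}$ the first $m$ entries of $b$; $\alpha^{(m)}$ is the first $m$ coordinates of $\alpha$. $\mathrm{Cnt}_m(S)=|\{y\in S:h^{(m)}(y)=\alpha^{(m)}\}|$. $q(w,m)=\prod_{j=1}^m(\tfrac12+\tfrac12(1-2p_j)^w)$ with $0^0=1$. $c_S(w,x)=|\{y\in S: d(x,y)=w\}|$, where $d$ is Hamming distance.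
   Formalization: The parameters $p_1,\dots,p_n$ are rational numbers in (0, ½] rather than real numbers. -}

module Defs where

open import Data.Bool using (Bool; true; false; _∧_; _xor_; if_then_else_)
open import Data.Nat as ℕ using (ℕ; zero; suc)
open import Data.Fin using (Fin; toℕ)
open import Data.Vec using (Vec; []; _∷_; lookup; zipWith; foldr; tabulate)
open import Data.List as List using (List; []; _∷_; _++_; concatMap; upTo; map)
open import Data.Rational using (ℚ; 0ℚ; 1ℚ; ½; _+_; _*_; _-_)

-- Bit vectors {0,1}^n and matrices over F_2 (n×n, stored as a vector of rows)
Bits : ℕ → Set
Bits n = Vec Bool n

Mat : ℕ → Set
Mat n = Vec (Vec Bool n) n

allVecsOf : {A : Set} → List A → (n : ℕ) → List (Vec A n)
allVecsOf xs zero = [] ∷ []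
allVecsOf xs (suc n) = concatMap (λ x → map (x ∷_) (allVecsOf xs n)) xs

allBits : (n : ℕ) → List (Bits n)
allBits = allVecsOf (false ∷ true ∷ [])

allMats : (n : ℕ) → List (Mat n)
allMats n = allVecsOf (allBits n) n

sumL : {A : Set} → List A → (A → ℚ) → ℚ
sumL xs f = List.foldr (λ x acc → f x + acc) 0ℚ xs

prodL : {A : Set} → List A → (A → ℚ) → ℚ
prodL xs f = List.foldr (λ x acc → f x * acc) 1ℚ xs

sumV : {n : ℕ} → Vec ℚ n → ℚ
sumV = foldr _ _+_ 0ℚ

prodV : {n : ℕ} → Vec ℚ n → ℚ
prodV = foldr _ _*_ 1ℚ

-- natural-number power of a rational (x ^ 0 = 1, so 0^0 = 1)
_^ℚ_ : ℚ → ℕ → ℚ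
x ^ℚ zero = 1ℚ
x ^ℚ suc k = x * (x ^ℚ k)

𝟙 : Bool → ℚ
𝟙 true = 1ℚ
𝟙 false = 0ℚ

ℕtoℚ : ℕ → ℚ
ℕtoℚ zero = 0ℚ
ℕtoℚ (suc k) = 1ℚ + ℕtoℚ k

dot : {n : ℕ} → Bits n → Bits n → Bool
dot u v = foldr _ _xor_ false (zipWith _∧_ u v)

eqB : Bool → Bool → Bool
eqB true true = true
eqB false false = true
eqB _ _ = false

hamming : {n : ℕ} → Bits n → Bits n → ℕ
hamming u v = foldr _ (λ d acc → if d then suc acc else acc) 0 (zipWith _xor_ u v)

_<ᵇ_ : ℕ → ℕ → Bool
i <ᵇ m = i ℕ.<ᵇ m

-- "h^{(m)}(y) = α^{(m)}" for h(x) = A x + b : rows/entries with index i < m agree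
hmEq : {n : ℕ} → ℕ → Mat n → Bits n → Bits n → Bits n → Bool
hmEq {n} m A b α y =
  foldr _ _∧_ true
    (tabulate (λ (i : Fin n) →
      if toℕ i <ᵇ m
        then eqB (dot (lookup A i) y xor lookup b i) (lookup α i)
        else true))

Subset : ℕ → Set
Subset n = Bits n → Bool

card : {n : ℕ} → Subset n → ℕ
card {n} S = List.length (List.filter (λ y → Data.Bool.T? (S y)) (allBits n))
  where import Data.Bool

sumS : {n : ℕ} → Subset n → (Bits n → ℚ) → ℚ
sumS {n} S f = sumL (allBits n) (λ y → 𝟙 (S y) * f y)

Cnt : {n : ℕ} → ℕ → Bits n → Subset n → Mat n → Bits n → ℕ
Cnt {n} m α S A b =
  List.length (List.filter (λ y → Data.Bool.T? (S y ∧ hmEq m A b α y)) (allBits n))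
  where import Data.Bool

bern : ℚ → Bool → ℚ
bern p true = p
bern p false = 1ℚ - p

-- Probability of (A, b) under H_{p_i}(n,n): row i of A Bernoulli(p_i), b uniform
weight : {n : ℕ} → (Fin n → ℚ) → Mat n → Bits n → ℚ
weight {n} p A b =
  prodV (tabulate (λ (i : Fin n) → prodV (Data.Vec.map (bern (p i)) (lookup A i))))
  * prodV (Data.Vec.map (bern ½) b)
  where import Data.Vec

Ex : {n : ℕ} → (Fin n → ℚ) → (Mat n → Bits n → ℚ) → ℚ
Ex {n} p f = sumL (allMats n) (λ A → sumL (allBits n) (λ b → weight p A b * f A b))

Pr : {n : ℕ} → (Fin n → ℚ) → (Mat n → Bits n → Bool) → ℚ
Pr p E = Ex p (λ A b → 𝟙 (E A b))

cS : {n : ℕ} → Subset n → ℕ → Bits n → ℕ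
cS {n} S w x =
  List.length (List.filter (λ y → Data.Bool.T? (S y ∧ (hamming x y ℕ.≡ᵇ w))) (allBits n))
  where import Data.Bool

-- q(w, m) = ∏_{j=1}^m (1/2 + 1/2 (1 - 2 p_j)^w)   (0-indexed: j = 0..m-1)
q : {n : ℕ} → (Fin n → ℚ) → ℕ → ℕ → ℚ
q {n} p w m =
  prodV (tabulate (λ (j : Fin n) →
    if toℕ j <ᵇ m then ½ + ½ * ((1ℚ - (p j + p j)) ^ℚ w) else 1ℚ))

halfPow : ℕ → ℚ
halfPow m = ½ ^ℚ m

{-# OPTIONS --safe #-}
-- Both the weight of (A, b) and the event h⁽ᵐ⁾(y₁) = h⁽ᵐ⁾(y₂) = α⁽ᵐ⁾ factor over the rows i, pairing
-- row i of A with bᵢ, so the probability of the event is a product of one-row probabilities. A row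
-- i ≥ m contributes 1; a row i < m contributes ½ · Pr[r·y₁ = r·y₂] = ½ (½ + ½ E[(−1)^(r·y₁ + r·y₂)]),
-- and the expectation is (1 − 2pᵢ)^d(y₁,y₂) because only coordinates where y₁ and y₂ differ see the
-- Bernoulli bit. Hence the event has probability 2⁻ᵐ q(d(y₁,y₂), m). With y₁ = y₂ this is 2⁻ᵐ, which
-- gives (1) by linearity of expectation; (2) follows by grouping the pairs by their distance.
module Submission where

open import Defs
open import Data.Nat using (ℕ; suc; _≤_)
open import Data.Bool using (_∧_)
open import Data.Fin using (Fin)
open import Data.Product using (_×_)
open import Data.List using (upTo)
open import Data.Rational using (ℚ; 0ℚ; ½; _<_; _*_)
open import Data.Rational renaming (_≤_ to _≤ℚ_)
open import Relation.Binary.PropositionalEquality using (_≡_)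

open import Data.Bool using (Bool; true; false; _xor_; if_then_else_; T?)
open import Data.Nat using (zero; z≤n; s≤s; _≡ᵇ_)
open import Data.Nat.Properties using (m≤n⇒m≤1+n)
open import Data.Fin using (toℕ) renaming (zero to fzero; suc to fsuc)
open import Data.Vec as Vec using (Vec; []; _∷_; lookup; tabulate)
open import Data.List as List using (List; []; _∷_; _++_; concatMap; filter; length)
open import Data.List.Relation.Unary.All as All using (All; []; _∷_)
open import Data.List.Relation.Unary.Any using (here; there)
open import Data.List.Relation.Unary.AllPairs using (_∷_)
open import Data.List.Relation.Unary.Unique.Propositional using (Unique)
open import Data.List.Relation.Unary.Unique.Propositional.Properties using (upTo⁺)
open import Data.List.Membership.Propositional using (_∈_)
open import Data.List.Membership.Propositional.Properties using (∈-upTo⁺)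
open import Data.Rational using (1ℚ; _+_; _-_; -_)
import Data.Rational.Properties as ℚ
open import Data.Rational.Solver using (module +-*-Solver)
open +-*-Solver
open import Relation.Binary.PropositionalEquality using (refl; sym; trans; cong; cong₂; _≢_; module ≡-Reasoning)
open import Data.Empty using (⊥-elim)
open import Function using (_∘_)
open import Data.Bool.Properties using (∧-idem)
open import Data.Product using (_,_)
open ≡-Reasoning

sumL-cong : {A : Set} (xs : List A) {f g : A → ℚ} → (∀ x → f x ≡ g x) → sumL xs f ≡ sumL xs g
sumL-cong []       f≗g = refl
sumL-cong (x ∷ xs) f≗g = cong₂ _+_ (f≗g x) (sumL-cong xs f≗g)

sumL-++ : {A : Set} (xs ys : List A) (f : A → ℚ) → sumL (xs ++ ys) f ≡ sumL xs f + sumL ys f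
sumL-++ []       ys f = sym (ℚ.+-identityˡ _)
sumL-++ (x ∷ xs) ys f = trans (cong (f x +_) (sumL-++ xs ys f)) (sym (ℚ.+-assoc (f x) _ _))

sumL-map : {A B : Set} (h : A → B) (xs : List A) (f : B → ℚ) →
  sumL (List.map h xs) f ≡ sumL xs (λ x → f (h x))
sumL-map h []       f = refl
sumL-map h (x ∷ xs) f = cong (f (h x) +_) (sumL-map h xs f)

sumL-concatMap : {A B : Set} (g : A → List B) (xs : List A) (f : B → ℚ) →
  sumL (concatMap g xs) f ≡ sumL xs (λ x → sumL (g x) f)
sumL-concatMap g []       f = refl
sumL-concatMap g (x ∷ xs) f =
  trans (sumL-++ (g x) (concatMap g xs) f) (cong (sumL (g x) f +_) (sumL-concatMap g xs f))

sumL-zero : {A : Set} (xs : List A) → sumL xs (λ _ → 0ℚ) ≡ 0ℚ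
sumL-zero []       = refl
sumL-zero (x ∷ xs) = trans (ℚ.+-identityˡ _) (sumL-zero xs)

sumL-+ : {A : Set} (xs : List A) (f g : A → ℚ) → sumL xs (λ x → f x + g x) ≡ sumL xs f + sumL xs g
sumL-+ []       f g = refl
sumL-+ (x ∷ xs) f g = trans (cong ((f x + g x) +_) (sumL-+ xs f g))
  (solve 4 (λ a b c d → (a :+ b) :+ (c :+ d) := (a :+ c) :+ (b :+ d)) refl
    (f x) (g x) (sumL xs f) (sumL xs g))

sumL-*ˡ : {A : Set} (xs : List A) (c : ℚ) (f : A → ℚ) → sumL xs (λ x → c * f x) ≡ c * sumL xs f
sumL-*ˡ []       c f = sym (ℚ.*-zeroʳ c)
sumL-*ˡ (x ∷ xs) c f = trans (cong (c * f x +_) (sumL-*ˡ xs c f)) (sym (ℚ.*-distribˡ-+ c (f x) _))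

sumL-*ʳ : {A : Set} (xs : List A) (c : ℚ) (f : A → ℚ) → sumL xs (λ x → f x * c) ≡ sumL xs f * c
sumL-*ʳ xs c f = trans (sumL-cong xs (λ x → ℚ.*-comm (f x) c)) (trans (sumL-*ˡ xs c f) (ℚ.*-comm c _))

sumL-comm : {A B : Set} (xs : List A) (ys : List B) (f : A → B → ℚ) →
  sumL xs (λ x → sumL ys (f x)) ≡ sumL ys (λ y → sumL xs (λ x → f x y))
sumL-comm []       ys f = sym (sumL-zero ys)
sumL-comm (x ∷ xs) ys f =
  trans (cong (sumL ys (f x) +_) (sumL-comm xs ys f)) (sym (sumL-+ ys (f x) _))

𝟙-∧ : ∀ a b → 𝟙 (a ∧ b) ≡ 𝟙 a * 𝟙 b
𝟙-∧ false b = sym (ℚ.*-zeroˡ (𝟙 b))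
𝟙-∧ true  b = sym (ℚ.*-identityˡ (𝟙 b))

ℕtoℚ-length-filter : {A : Set} (xs : List A) (P : A → Bool) →
  ℕtoℚ (length (filter (λ x → T? (P x)) xs)) ≡ sumL xs (λ x → 𝟙 (P x))
ℕtoℚ-length-filter []       P = refl
ℕtoℚ-length-filter (x ∷ xs) P with P x
... | true  = cong (1ℚ +_) (ℕtoℚ-length-filter xs P)
... | false = trans (ℕtoℚ-length-filter xs P) (sym (ℚ.+-identityˡ _))

𝟙-≡ᵇ-refl : ∀ k → 𝟙 (k ≡ᵇ k) ≡ 1ℚ
𝟙-≡ᵇ-refl zero    = refl
𝟙-≡ᵇ-refl (suc k) = 𝟙-≡ᵇ-refl k

𝟙-≡ᵇ-≢ : ∀ k w → k ≢ w → 𝟙 (k ≡ᵇ w) ≡ 0ℚ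
𝟙-≡ᵇ-≢ zero    zero    k≢w = ⊥-elim (k≢w refl)
𝟙-≡ᵇ-≢ zero    (suc w) k≢w = refl
𝟙-≡ᵇ-≢ (suc k) zero    k≢w = refl
𝟙-≡ᵇ-≢ (suc k) (suc w) k≢w = 𝟙-≡ᵇ-≢ k w (λ k≡w → k≢w (cong suc k≡w))

module _ (g : ℕ → ℚ) (k : ℕ) where

  sumL-δ-∉ : {ws : List ℕ} → All (k ≢_) ws → sumL ws (λ w → 𝟙 (k ≡ᵇ w) * g w) ≡ 0ℚ
  sumL-δ-∉ []                     = refl
  sumL-δ-∉ {w ∷ ws} (k≢w ∷ k∉ws) =
    cong₂ _+_ (trans (cong (_* g w) (𝟙-≡ᵇ-≢ k w k≢w)) (ℚ.*-zeroˡ (g w))) (sumL-δ-∉ k∉ws)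

  sumL-δ : {ws : List ℕ} → Unique ws → k ∈ ws → sumL ws (λ w → 𝟙 (k ≡ᵇ w) * g w) ≡ g k
  sumL-δ {k ∷ ws} (k∉ws ∷ _) (here refl) =
    trans (cong₂ _+_ (trans (cong (_* g k) (𝟙-≡ᵇ-refl k)) (ℚ.*-identityˡ (g k))) (sumL-δ-∉ k∉ws))
          (ℚ.+-identityʳ (g k))
  sumL-δ {w ∷ ws} (w∉ws ∷ ws-unique) (there k∈ws) =
    trans (cong₂ _+_ (trans (cong (_* g w) (𝟙-≡ᵇ-≢ k w (λ k≡w → All.lookup w∉ws k∈ws (sym k≡w))))
                            (ℚ.*-zeroˡ (g w)))
                     (sumL-δ ws-unique k∈ws))
          (ℚ.+-identityˡ (g k))

sumL-allVecsOf-suc : {A : Set} (xs : List A) (n : ℕ) (f : Vec A (suc n) → ℚ) →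
  sumL (allVecsOf xs (suc n)) f ≡ sumL xs (λ x → sumL (allVecsOf xs n) (λ v → f (x ∷ v)))
sumL-allVecsOf-suc xs n f =
  trans (sumL-concatMap _ xs f) (sumL-cong xs (λ x → sumL-map (x ∷_) (allVecsOf xs n) f))

sumL-allVecsOf-prodV : {A : Set} (xs : List A) (n : ℕ) (f : Fin n → A → ℚ) →
  sumL (allVecsOf xs n) (λ v → prodV (tabulate (λ i → f i (lookup v i))))
    ≡ prodV (tabulate (λ i → sumL xs (f i)))
sumL-allVecsOf-prodV xs zero    f = ℚ.+-identityʳ 1ℚ
sumL-allVecsOf-prodV {A} xs (suc n) f = begin
  sumL (allVecsOf xs (suc n)) (λ v → prodV (tabulate (λ i → f i (lookup v i))))
    ≡⟨ sumL-allVecsOf-suc xs n (λ v → prodV (tabulate (λ i → f i (lookup v i)))) ⟩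
  sumL xs (λ x → sumL (allVecsOf xs n) (λ v → f fzero x * tail v))
    ≡⟨ sumL-cong xs (λ x → trans (sumL-*ˡ (allVecsOf xs n) (f fzero x) tail)
                                 (cong (f fzero x *_) (sumL-allVecsOf-prodV xs n (λ i → f (fsuc i))))) ⟩
  sumL xs (λ x → f fzero x * prodV (tabulate (λ i → sumL xs (f (fsuc i)))))
    ≡⟨ sumL-*ʳ xs _ (f fzero) ⟩
  sumL xs (f fzero) * prodV (tabulate (λ i → sumL xs (f (fsuc i)))) ∎
  where
  tail : Vec A n → ℚ
  tail v = prodV (tabulate (λ i → f (fsuc i) (lookup v i)))

prodV-tabulate-cong : ∀ n {f g : Fin n → ℚ} → (∀ i → f i ≡ g i) → prodV (tabulate f) ≡ prodV (tabulate g)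
prodV-tabulate-cong zero    f≗g = refl
prodV-tabulate-cong (suc n) f≗g = cong₂ _*_ (f≗g fzero) (prodV-tabulate-cong n (λ i → f≗g (fsuc i)))

prodV-tabulate-* : ∀ n (f g : Fin n → ℚ) →
  prodV (tabulate f) * prodV (tabulate g) ≡ prodV (tabulate (λ i → f i * g i))
prodV-tabulate-* zero    f g = refl
prodV-tabulate-* (suc n) f g = trans
  (solve 4 (λ a b c d → (a :* b) :* (c :* d) := (a :* c) :* (b :* d)) refl
    (f fzero) (prodV (tabulate (λ i → f (fsuc i)))) (g fzero) (prodV (tabulate (λ i → g (fsuc i)))))
  (cong (f fzero * g fzero *_) (prodV-tabulate-* n (λ i → f (fsuc i)) (λ i → g (fsuc i))))

prodV-map : ∀ {n} (f : Bool → ℚ) (v : Bits n) → prodV (Vec.map f v) ≡ prodV (tabulate (λ i → f (lookup v i)))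
prodV-map f []      = refl
prodV-map f (x ∷ v) = cong (f x *_) (prodV-map f v)

prodV-tabulate-1 : ∀ n (f : Fin n → ℚ) → (∀ i → f i ≡ 1ℚ) → prodV (tabulate f) ≡ 1ℚ
prodV-tabulate-1 zero    f f≗1 = refl
prodV-tabulate-1 (suc n) f f≗1 = cong₂ _*_ (f≗1 fzero) (prodV-tabulate-1 n (λ i → f (fsuc i)) (λ i → f≗1 (fsuc i)))

𝟙-all : ∀ n (g : Fin n → Bool) → 𝟙 (Vec.foldr _ _∧_ true (tabulate g)) ≡ prodV (tabulate (λ i → 𝟙 (g i)))
𝟙-all zero    g = refl
𝟙-all (suc n) g = trans (𝟙-∧ (g fzero) _) (cong (𝟙 (g fzero) *_) (𝟙-all n (λ i → g (fsuc i))))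

prodV-tabulate-½ : ∀ n m (X : Fin n → ℚ) → m ≤ n →
  prodV (tabulate (λ i → if toℕ i <ᵇ m then ½ * X i else 1ℚ))
    ≡ halfPow m * prodV (tabulate (λ i → if toℕ i <ᵇ m then X i else 1ℚ))
prodV-tabulate-½ n       zero    X z≤n = sym (ℚ.*-identityˡ _)
prodV-tabulate-½ (suc n) (suc m) X (s≤s m≤n) =
  trans (cong (½ * X fzero *_) (prodV-tabulate-½ n m (λ i → X (fsuc i)) m≤n))
    (solve 4 (λ h x k r → (h :* x) :* (k :* r) := (h :* k) :* (x :* r)) refl
      ½ (X fzero) (halfPow m) (prodV (tabulate (λ i → if toℕ i <ᵇ m then X (fsuc i) else 1ℚ))))

bools : List Bool
bools = false ∷ true ∷ []

χ : Bool → ℚ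
χ false = 1ℚ
χ true  = - 1ℚ

χ-xor : ∀ a b → χ (a xor b) ≡ χ a * χ b
χ-xor false false = refl
χ-xor false true  = refl
χ-xor true  false = refl
χ-xor true  true  = refl

bernVec : {n : ℕ} → ℚ → Bits n → ℚ
bernVec p r = prodV (Vec.map (bern p) r)

sumL-bernVec : ∀ n p → sumL (allBits n) (bernVec p) ≡ 1ℚ
sumL-bernVec zero    p = refl
sumL-bernVec (suc n) p = begin
  sumL (allBits (suc n)) (bernVec p)
    ≡⟨ sumL-allVecsOf-suc bools n (bernVec p) ⟩
  sumL bools (λ x → sumL (allBits n) (λ v → bern p x * bernVec p v))
    ≡⟨ sumL-cong bools (λ x → trans (sumL-*ˡ (allBits n) (bern p x) (bernVec p))
                                   (cong (bern p x *_) (sumL-bernVec n p))) ⟩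
  (1ℚ - p) * 1ℚ + (p * 1ℚ + 0ℚ)
    ≡⟨ solve 1 (λ p → (con 1ℚ :- p) :* con 1ℚ :+ (p :* con 1ℚ :+ con 0ℚ) := con 1ℚ) refl p ⟩
  1ℚ ∎

sumL-bern-χ-∧ : ∀ p a b →
  sumL bools (λ x → bern p x * (χ (x ∧ a) * χ (x ∧ b))) ≡ (if a xor b then 1ℚ - (p + p) else 1ℚ)
sumL-bern-χ-∧ p false false =
  solve 1 (λ p → (con 1ℚ :- p) :* (con 1ℚ :* con 1ℚ) :+ (p :* (con 1ℚ :* con 1ℚ) :+ con 0ℚ) := con 1ℚ) refl p
sumL-bern-χ-∧ p false true  =
  solve 1 (λ p → (con 1ℚ :- p) :* (con 1ℚ :* con 1ℚ) :+ (p :* (con 1ℚ :* con (- 1ℚ)) :+ con 0ℚ)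
                   := con 1ℚ :- (p :+ p)) refl p
sumL-bern-χ-∧ p true  false =
  solve 1 (λ p → (con 1ℚ :- p) :* (con 1ℚ :* con 1ℚ) :+ (p :* (con (- 1ℚ) :* con 1ℚ) :+ con 0ℚ)
                   := con 1ℚ :- (p :+ p)) refl p
sumL-bern-χ-∧ p true  true  =
  solve 1 (λ p → (con 1ℚ :- p) :* (con 1ℚ :* con 1ℚ) :+ (p :* (con (- 1ℚ) :* con (- 1ℚ)) :+ con 0ℚ)
                   := con 1ℚ) refl p

^ℚ-if-suc : ∀ ρ k c → (if c then ρ else 1ℚ) * (ρ ^ℚ k) ≡ ρ ^ℚ (if c then suc k else k)
^ℚ-if-suc ρ k true  = refl
^ℚ-if-suc ρ k false = ℚ.*-identityˡ (ρ ^ℚ k)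

sumL-bernVec-χ-dot : ∀ n p (y₁ y₂ : Bits n) →
  sumL (allBits n) (λ r → bernVec p r * (χ (dot r y₁) * χ (dot r y₂))) ≡ (1ℚ - (p + p)) ^ℚ hamming y₁ y₂
sumL-bernVec-χ-dot zero    p []       []       = refl
sumL-bernVec-χ-dot (suc n) p (a ∷ y₁) (b ∷ y₂) = begin
  sumL (allBits (suc n)) (λ r → bernVec p r * (χ (dot r (a ∷ y₁)) * χ (dot r (b ∷ y₂))))
    ≡⟨ sumL-allVecsOf-suc bools n (λ r → bernVec p r * (χ (dot r (a ∷ y₁)) * χ (dot r (b ∷ y₂)))) ⟩
  sumL bools (λ x → sumL (allBits n) (λ v →
      (bern p x * bernVec p v) * (χ ((x ∧ a) xor dot v y₁) * χ ((x ∧ b) xor dot v y₂))))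
    ≡⟨ sumL-cong bools (λ x → trans (sumL-cong (allBits n) (regroup x))
         (trans (sumL-*ˡ (allBits n) (K x) (λ v → bernVec p v * (χ (dot v y₁) * χ (dot v y₂))))
                (cong (K x *_) (sumL-bernVec-χ-dot n p y₁ y₂)))) ⟩
  sumL bools (λ x → K x * ρ ^ℚ hamming y₁ y₂)
    ≡⟨ sumL-*ʳ bools (ρ ^ℚ hamming y₁ y₂) K ⟩
  sumL bools K * ρ ^ℚ hamming y₁ y₂
    ≡⟨ cong (_* ρ ^ℚ hamming y₁ y₂) (sumL-bern-χ-∧ p a b) ⟩
  (if a xor b then ρ else 1ℚ) * ρ ^ℚ hamming y₁ y₂
    ≡⟨ ^ℚ-if-suc ρ (hamming y₁ y₂) (a xor b) ⟩
  ρ ^ℚ hamming (a ∷ y₁) (b ∷ y₂) ∎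
  where
  ρ : ℚ
  ρ = 1ℚ - (p + p)
  K : Bool → ℚ
  K x = bern p x * (χ (x ∧ a) * χ (x ∧ b))
  regroup : ∀ x v → (bern p x * bernVec p v) * (χ ((x ∧ a) xor dot v y₁) * χ ((x ∧ b) xor dot v y₂))
                  ≡ K x * (bernVec p v * (χ (dot v y₁) * χ (dot v y₂)))
  regroup x v rewrite χ-xor (x ∧ a) (dot v y₁) | χ-xor (x ∧ b) (dot v y₂) =
    solve 6 (λ B M c₁ d₁ c₂ d₂ → (B :* M) :* ((c₁ :* d₁) :* (c₂ :* d₂)) := (B :* (c₁ :* c₂)) :* (M :* (d₁ :* d₂)))
      refl (bern p x) (bernVec p v) (χ (x ∧ a)) (χ (dot v y₁)) (χ (x ∧ b)) (χ (dot v y₂))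

rowAgrees : {n : ℕ} → Bool → Bits n → Bool → Bits n → Bool → Bool
rowAgrees checked y a r c = if checked then eqB (dot r y xor c) a else true

sumL-bern½-agree : ∀ d₁ d₂ a →
  sumL bools (λ c → bern ½ c * (𝟙 (eqB (d₁ xor c) a) * 𝟙 (eqB (d₂ xor c) a))) ≡ ½ * (½ + ½ * (χ d₁ * χ d₂))
sumL-bern½-agree false false false = refl
sumL-bern½-agree false false true  = refl
sumL-bern½-agree false true  false = refl
sumL-bern½-agree false true  true  = refl
sumL-bern½-agree true  false false = refl
sumL-bern½-agree true  false true  = refl
sumL-bern½-agree true  true  false = refl
sumL-bern½-agree true  true  true  = refl

rowProb : ∀ n checked p a (y₁ y₂ : Bits n) →
  sumL (allBits n) (λ r → sumL bools (λ c →
      bernVec p r * (bern ½ c * (𝟙 (rowAgrees checked y₁ a r c) * 𝟙 (rowAgrees checked y₂ a r c)))))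
    ≡ (if checked then ½ * (½ + ½ * ((1ℚ - (p + p)) ^ℚ hamming y₁ y₂)) else 1ℚ)
rowProb n false p a y₁ y₂ = begin
  sumL (allBits n) (λ r → sumL bools (λ c → bernVec p r * (bern ½ c * (1ℚ * 1ℚ))))
    ≡⟨ sumL-cong (allBits n) (λ r → trans (sumL-*ˡ bools (bernVec p r) (λ c → bern ½ c * (1ℚ * 1ℚ)))
                                          (ℚ.*-identityʳ (bernVec p r))) ⟩
  sumL (allBits n) (bernVec p)
    ≡⟨ sumL-bernVec n p ⟩
  1ℚ ∎
rowProb n true p a y₁ y₂ = begin
  sumL (allBits n) (λ r → sumL bools (λ c → bernVec p r * (bern ½ c * (𝟙 (agree₁ r c) * 𝟙 (agree₂ r c)))))
    ≡⟨ sumL-cong (allBits n) (λ r → trans (sumL-*ˡ bools (bernVec p r) (λ c → bern ½ c * (𝟙 (agree₁ r c) * 𝟙 (agree₂ r c))))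
         (trans (cong (bernVec p r *_) (sumL-bern½-agree (dot r y₁) (dot r y₂) a)) (expand r))) ⟩
  sumL (allBits n) (λ r → ¼ * bernVec p r + ¼ * correlation r)
    ≡⟨ sumL-+ (allBits n) (λ r → ¼ * bernVec p r) (λ r → ¼ * correlation r) ⟩
  sumL (allBits n) (λ r → ¼ * bernVec p r) + sumL (allBits n) (λ r → ¼ * correlation r)
    ≡⟨ cong₂ _+_ (trans (sumL-*ˡ (allBits n) ¼ (bernVec p)) (cong (¼ *_) (sumL-bernVec n p)))
                 (trans (sumL-*ˡ (allBits n) ¼ correlation) (cong (¼ *_) (sumL-bernVec-χ-dot n p y₁ y₂))) ⟩
  ¼ * 1ℚ + ¼ * E
    ≡⟨ solve 2 (λ h e → h :* h :* con 1ℚ :+ h :* h :* e := h :* (h :+ h :* e)) refl ½ E ⟩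
  ½ * (½ + ½ * E) ∎
  where
  ¼ : ℚ
  ¼ = ½ * ½
  E : ℚ
  E = (1ℚ - (p + p)) ^ℚ hamming y₁ y₂
  agree₁ agree₂ : Bits n → Bool → Bool
  agree₁ = rowAgrees true y₁ a
  agree₂ = rowAgrees true y₂ a
  correlation : Bits n → ℚ
  correlation r = bernVec p r * (χ (dot r y₁) * χ (dot r y₂))
  expand : ∀ r → bernVec p r * (½ * (½ + ½ * (χ (dot r y₁) * χ (dot r y₂)))) ≡ ¼ * bernVec p r + ¼ * correlation r
  expand r = solve 4 (λ M h x y → M :* (h :* (h :+ h :* (x :* y))) := h :* h :* M :+ h :* h :* (M :* (x :* y)))
    refl (bernVec p r) ½ (χ (dot r y₁)) (χ (dot r y₂))

module _ {n : ℕ} (p : Fin n → ℚ) (α : Bits n) (m : ℕ) (y₁ y₂ : Bits n) where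

  private
    agree₁ agree₂ : Fin n → Bits n → Bool → Bool
    agree₁ i = rowAgrees (toℕ i <ᵇ m) y₁ (lookup α i)
    agree₂ i = rowAgrees (toℕ i <ᵇ m) y₂ (lookup α i)

    rowFactor : Fin n → Bits n → Bool → ℚ
    rowFactor i r c = bernVec (p i) r * (bern ½ c * (𝟙 (agree₁ i r c) * 𝟙 (agree₂ i r c)))

  weight-hmEq-factorises : ∀ A b →
    weight p A b * 𝟙 (hmEq m A b α y₁ ∧ hmEq m A b α y₂)
      ≡ prodV (tabulate (λ i → rowFactor i (lookup A i) (lookup b i)))
  weight-hmEq-factorises A b = begin
    (WA * prodV (Vec.map (bern ½) b)) * 𝟙 (hmEq m A b α y₁ ∧ hmEq m A b α y₂)
      ≡⟨ cong₂ (λ u v → (WA * u) * v) (prodV-map (bern ½) b)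
           (trans (𝟙-∧ (hmEq m A b α y₁) (hmEq m A b α y₂))
             (trans (cong₂ _*_ (𝟙-all n hit₁) (𝟙-all n hit₂)) (prodV-tabulate-* n (𝟙 ∘ hit₁) (𝟙 ∘ hit₂)))) ⟩
    (WA * prodV (tabulate (bern ½ ∘ lookup b))) * prodV (tabulate (λ i → 𝟙 (hit₁ i) * 𝟙 (hit₂ i)))
      ≡⟨ ℚ.*-assoc WA _ _ ⟩
    WA * (prodV (tabulate (bern ½ ∘ lookup b)) * prodV (tabulate (λ i → 𝟙 (hit₁ i) * 𝟙 (hit₂ i))))
      ≡⟨ cong (WA *_) (prodV-tabulate-* n (bern ½ ∘ lookup b) (λ i → 𝟙 (hit₁ i) * 𝟙 (hit₂ i))) ⟩
    WA * prodV (tabulate (λ i → bern ½ (lookup b i) * (𝟙 (hit₁ i) * 𝟙 (hit₂ i))))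
      ≡⟨ prodV-tabulate-* n _ _ ⟩
    prodV (tabulate (λ i → rowFactor i (lookup A i) (lookup b i))) ∎
    where
    WA : ℚ
    WA = prodV (tabulate (λ i → bernVec (p i) (lookup A i)))
    hit₁ hit₂ : Fin n → Bool
    hit₁ i = agree₁ i (lookup A i) (lookup b i)
    hit₂ i = agree₂ i (lookup A i) (lookup b i)

  Pr-hmEq-both : m ≤ n → Pr p (λ A b → hmEq m A b α y₁ ∧ hmEq m A b α y₂) ≡ halfPow m * q p (hamming y₁ y₂) m
  Pr-hmEq-both m≤n = begin
    Pr p (λ A b → hmEq m A b α y₁ ∧ hmEq m A b α y₂)
      ≡⟨ sumL-cong (allMats n) (λ A → trans (sumL-cong (allBits n) (weight-hmEq-factorises A))
                                            (sumL-allVecsOf-prodV bools n (λ i → rowFactor i (lookup A i)))) ⟩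
    sumL (allMats n) (λ A → prodV (tabulate (λ i → sumL bools (rowFactor i (lookup A i)))))
      ≡⟨ sumL-allVecsOf-prodV (allBits n) n (λ i r → sumL bools (rowFactor i r)) ⟩
    prodV (tabulate (λ i → sumL (allBits n) (λ r → sumL bools (rowFactor i r))))
      ≡⟨ prodV-tabulate-cong n (λ i → rowProb n (toℕ i <ᵇ m) (p i) (lookup α i) y₁ y₂) ⟩
    prodV (tabulate (λ i → if toℕ i <ᵇ m then ½ * X i else 1ℚ))
      ≡⟨ prodV-tabulate-½ n m X m≤n ⟩
    halfPow m * q p (hamming y₁ y₂) m ∎
    where
    X : Fin n → ℚ
    X i = ½ + ½ * ((1ℚ - (p i + p i)) ^ℚ hamming y₁ y₂)

hamming-≤ : ∀ {n} (x y : Bits n) → hamming x y ≤ n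
hamming-≤ []          []          = z≤n
hamming-≤ (false ∷ x) (false ∷ y) = m≤n⇒m≤1+n (hamming-≤ x y)
hamming-≤ (false ∷ x) (true  ∷ y) = s≤s (hamming-≤ x y)
hamming-≤ (true  ∷ x) (false ∷ y) = s≤s (hamming-≤ x y)
hamming-≤ (true  ∷ x) (true  ∷ y) = m≤n⇒m≤1+n (hamming-≤ x y)

hamming-self : ∀ {n} (x : Bits n) → hamming x x ≡ 0
hamming-self []          = refl
hamming-self (false ∷ x) = hamming-self x
hamming-self (true  ∷ x) = hamming-self x

q-zero : ∀ {n} (p : Fin n → ℚ) m → q p 0 m ≡ 1ℚ
q-zero {n} p m = prodV-tabulate-1 n _ (λ j → ½+½≡1 (toℕ j <ᵇ m))
  where
  ½+½≡1 : ∀ c → (if c then ½ + ½ * 1ℚ else 1ℚ) ≡ 1ℚ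
  ½+½≡1 true  = refl
  ½+½≡1 false = refl

sumS-cong : ∀ {n} (S : Subset n) {f g : Bits n → ℚ} → (∀ y → f y ≡ g y) → sumS S f ≡ sumS S g
sumS-cong {n} S f≗g = sumL-cong (allBits n) (λ y → cong (𝟙 (S y) *_) (f≗g y))

sumS-*ˡ : ∀ {n} (S : Subset n) c (f : Bits n → ℚ) → sumS S (λ y → c * f y) ≡ c * sumS S f
sumS-*ˡ {n} S c f = trans
  (sumL-cong (allBits n) (λ y → solve 3 (λ s c x → s :* (c :* x) := c :* (s :* x)) refl (𝟙 (S y)) c (f y)))
  (sumL-*ˡ (allBits n) c (λ y → 𝟙 (S y) * f y))

sumL-cS : ∀ {n} (S : Subset n) (x : Bits n) (g : ℕ → ℚ) →
  sumL (upTo (suc n)) (λ w → ℕtoℚ (cS S w x) * g w) ≡ sumS S (λ y → g (hamming x y))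
sumL-cS {n} S x g = begin
  sumL W (λ w → ℕtoℚ (cS S w x) * g w)
    ≡⟨ sumL-cong W (λ w → trans (cong (_* g w) (ℕtoℚ-length-filter Y (λ y → S y ∧ (hamming x y ≡ᵇ w))))
                               (sym (sumL-*ʳ Y (g w) (λ y → 𝟙 (S y ∧ (hamming x y ≡ᵇ w)))))) ⟩
  sumL W (λ w → sumL Y (λ y → 𝟙 (S y ∧ (hamming x y ≡ᵇ w)) * g w))
    ≡⟨ sumL-comm W Y (λ w y → 𝟙 (S y ∧ (hamming x y ≡ᵇ w)) * g w) ⟩
  sumL Y (λ y → sumL W (λ w → 𝟙 (S y ∧ (hamming x y ≡ᵇ w)) * g w))
    ≡⟨ sumL-cong Y (λ y → trans (sumL-cong W (λ w → trans (cong (_* g w) (𝟙-∧ (S y) (hamming x y ≡ᵇ w)))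
                                                         (ℚ.*-assoc (𝟙 (S y)) _ (g w))))
                               (sumL-*ˡ W (𝟙 (S y)) (λ w → 𝟙 (hamming x y ≡ᵇ w) * g w))) ⟩
  sumS S (λ y → sumL W (λ w → 𝟙 (hamming x y ≡ᵇ w) * g w))
    ≡⟨ sumS-cong S (λ y → sumL-δ g (hamming x y) (upTo⁺ (suc n)) (∈-upTo⁺ (s≤s (hamming-≤ x y)))) ⟩
  sumS S (λ y → g (hamming x y)) ∎
  where
  W = upTo (suc n)
  Y = allBits n

module _ {n : ℕ} (p : Fin n → ℚ) where

  Ex-cong : {f g : Mat n → Bits n → ℚ} → (∀ A b → f A b ≡ g A b) → Ex p f ≡ Ex p g
  Ex-cong f≗g = sumL-cong (allMats n) (λ A → sumL-cong (allBits n) (λ b → cong (weight p A b *_) (f≗g A b)))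

  Ex-*ˡ : ∀ c (f : Mat n → Bits n → ℚ) → Ex p (λ A b → c * f A b) ≡ c * Ex p f
  Ex-*ˡ c f = trans
    (sumL-cong (allMats n) (λ A → trans
      (sumL-cong (allBits n) (λ b → solve 3 (λ w c x → w :* (c :* x) := c :* (w :* x)) refl (weight p A b) c (f A b)))
      (sumL-*ˡ (allBits n) c (λ b → weight p A b * f A b))))
    (sumL-*ˡ (allMats n) c (λ A → sumL (allBits n) (λ b → weight p A b * f A b)))

  Ex-sumL : {Y : Set} (ys : List Y) (f : Y → Mat n → Bits n → ℚ) →
    Ex p (λ A b → sumL ys (λ y → f y A b)) ≡ sumL ys (λ y → Ex p (f y))
  Ex-sumL ys f = begin
    Ex p (λ A b → sumL ys (λ y → f y A b))
      ≡⟨ sumL-cong (allMats n) (λ A → trans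
           (sumL-cong (allBits n) (λ b → sym (sumL-*ˡ ys (weight p A b) (λ y → f y A b))))
           (sumL-comm (allBits n) ys (λ b y → weight p A b * f y A b))) ⟩
    sumL (allMats n) (λ A → sumL ys (λ y → sumL (allBits n) (λ b → weight p A b * f y A b)))
      ≡⟨ sumL-comm (allMats n) ys (λ A y → sumL (allBits n) (λ b → weight p A b * f y A b)) ⟩
    sumL ys (λ y → Ex p (f y)) ∎

  module _ (α : Bits n) (m : ℕ) (m≤n : m ≤ n) where

    Pr-hmEq : ∀ y → Pr p (λ A b → hmEq m A b α y) ≡ halfPow m
    Pr-hmEq y = begin
      Pr p (λ A b → hmEq m A b α y)
        ≡⟨ Ex-cong (λ A b → cong 𝟙 (sym (∧-idem (hmEq m A b α y)))) ⟩
      Pr p (λ A b → hmEq m A b α y ∧ hmEq m A b α y)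
        ≡⟨ Pr-hmEq-both p α m y y m≤n ⟩
      halfPow m * q p (hamming y y) m
        ≡⟨ cong (λ w → halfPow m * q p w m) (hamming-self y) ⟩
      halfPow m * q p 0 m
        ≡⟨ trans (cong (halfPow m *_) (q-zero p m)) (ℚ.*-identityʳ (halfPow m)) ⟩
      halfPow m ∎

    Ex-Cnt : ∀ S → Ex p (λ A b → ℕtoℚ (Cnt m α S A b)) ≡ ℕtoℚ (card S) * halfPow m
    Ex-Cnt S = begin
      Ex p (λ A b → ℕtoℚ (Cnt m α S A b))
        ≡⟨ Ex-cong (λ A b → ℕtoℚ-length-filter Y (λ y → S y ∧ hmEq m A b α y)) ⟩
      Ex p (λ A b → sumL Y (λ y → 𝟙 (S y ∧ hmEq m A b α y)))
        ≡⟨ Ex-sumL Y (λ y A b → 𝟙 (S y ∧ hmEq m A b α y)) ⟩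
      sumL Y (λ y → Ex p (λ A b → 𝟙 (S y ∧ hmEq m A b α y)))
        ≡⟨ sumL-cong Y (λ y → trans (Ex-cong (λ A b → 𝟙-∧ (S y) (hmEq m A b α y)))
             (trans (Ex-*ˡ (𝟙 (S y)) (λ A b → 𝟙 (hmEq m A b α y))) (cong (𝟙 (S y) *_) (Pr-hmEq y)))) ⟩
      sumL Y (λ y → 𝟙 (S y) * halfPow m)
        ≡⟨ sumL-*ʳ Y (halfPow m) (λ y → 𝟙 (S y)) ⟩
      sumL Y (λ y → 𝟙 (S y)) * halfPow m
        ≡⟨ cong (_* halfPow m) (sym (ℕtoℚ-length-filter Y S)) ⟩
      ℕtoℚ (card S) * halfPow m ∎
      where
      Y = allBits n

proposition5 : (n : ℕ) (p : Fin n → ℚ) → (∀ i → (0ℚ < p i) × (p i ≤ℚ ½)) →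
    (α : Bits n) (m : ℕ) → 1 ≤ m → m ≤ n → (S : Subset n) →
    (Ex p (λ A b → ℕtoℚ (Cnt m α S A b)) ≡ ℕtoℚ (card S) * halfPow m)
    × (sumS S (λ y₁ → sumS S (λ y₂ →
          Pr p (λ A b → hmEq m A b α y₁ ∧ hmEq m A b α y₂)))
       ≡ halfPow m * sumS S (λ x →
          sumL (upTo (suc n)) (λ w → ℕtoℚ (cS S w x) * q p w m)))
proposition5 n p _ α m _ m≤n S = Ex-Cnt p α m m≤n S , pairSum
  where
  pairSum : sumS S (λ y₁ → sumS S (λ y₂ → Pr p (λ A b → hmEq m A b α y₁ ∧ hmEq m A b α y₂)))
          ≡ halfPow m * sumS S (λ x → sumL (upTo (suc n)) (λ w → ℕtoℚ (cS S w x) * q p w m))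
  pairSum = begin
    sumS S (λ y₁ → sumS S (λ y₂ → Pr p (λ A b → hmEq m A b α y₁ ∧ hmEq m A b α y₂)))
      ≡⟨ sumS-cong S (λ y₁ → trans (sumS-cong S (λ y₂ → Pr-hmEq-both p α m y₁ y₂ m≤n))
                                    (sumS-*ˡ S (halfPow m) (λ y₂ → q p (hamming y₁ y₂) m))) ⟩
    sumS S (λ x → halfPow m * sumS S (λ y → q p (hamming x y) m))
      ≡⟨ sumS-*ˡ S (halfPow m) (λ x → sumS S (λ y → q p (hamming x y) m)) ⟩
    halfPow m * sumS S (λ x → sumS S (λ y → q p (hamming x y) m))
      ≡⟨ cong (halfPow m *_) (sumS-cong S (λ x → sym (sumL-cS S x (λ w → q p w m)))) ⟩
    halfPow m * sumS S (λ x → sumL (upTo (suc n)) (λ w → ℕtoℚ (cS S w x) * q p w m)) ∎
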